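{- Let $q$ be a prime power and $t\ge1$ an integer. Let $\Omega$ be a $(t-2)$-dimensional subspace of a projective space over $\mathbb{F}_q$, let $\Gamma$ be a plane disjoint from $\Omega$, let $\bar B$ be a small minimal blocking set (with respect to lines) in $\Gamma$, let $\Pi=\langle\Omega,\Gamma\rangle$ and let $K=\bigcup_{\bar P\in\bar B}\langle\bar P,\Omega\rangle$ be the cone with vertex $\Omega$ and base $\bar B$. Then every plane $\pi$ of $\Pi$ meets $K$ either in $\pi$ itself, or in a union of lines through a fixed point, or in a minimal blocking set of $\pi$ projectively equivalent to $\bar B$.
   Context: A blocking set with respect to lines in a plane $\mathrm{PG}(2,q)$ meets every line; it is minimal if no proper subset is one; it is small if it has fewer than $3(q+1)/2$ points. -}

module Defs where

open import Level using (0ℓ)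
open import Data.Nat using (ℕ; zero; suc; _<_; _^_) renaming (_+_ to _+ℕ_; _*_ to _*ℕ_)
open import Data.Nat.Primality using (Prime)
open import Data.Fin using (Fin; zero; suc)
open import Data.Product using (Σ; ∃; _×_; _,_)
open import Data.Vec.Functional using (Vector; _∷_; [])
open import Relation.Binary.PropositionalEquality using (_≡_; _≢_)
open import Relation.Nullary using (¬_)
open import Algebra.Structures using (IsCommutativeRing)
open import Function.Bundles using (_↔_; _⇔_)

IsPrimePower : ℕ → Set
IsPrimePower q = Σ ℕ λ p → Σ ℕ λ k → Prime p × q ≡ p ^ suc k

record FiniteField (q : ℕ) : Set₁ where
  field
    F : Set
    _+_ _*_ : F → F → F
    -_ : F → F
    0# 1# : F
    isCommutativeRing : IsCommutativeRing _≡_ _+_ _*_ -_ 0# 1#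
    0≢1 : 0# ≢ 1#
    inverse : ∀ x → x ≢ 0# → Σ F λ y → x * y ≡ 1#
    enumeration : F ↔ Fin q

-- Projective geometry PG(m-1, q) modelled in the vector space F^m.
-- A projective point is represented by a nonzero vector (up to nonzero
-- scalars); a projective subspace of dimension d is given by a basis of
-- d+1 linearly independent vectors (its points are the nonzero vectors
-- of their span).
module Geometry {q : ℕ} (𝔽 : FiniteField q) (m : ℕ) where
  open FiniteField 𝔽

  V : Set
  V = Fin m → F

  0v : V
  0v _ = 0#

  _+v_ : V → V → V
  (u +v w) i = u i + w i

  _·_ : F → V → V
  (c · v) i = c * v i

  _≈v_ : V → V → Set
  u ≈v w = ∀ i → u i ≡ w i

  NonZeroV : V → Set
  NonZeroV v = ¬ (v ≈v 0v)

  lincomb : ∀ {k} → (Fin k → F) → Vector V k → V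
  lincomb {zero}  c b = 0v
  lincomb {suc k} c b = (c zero · b zero) +v lincomb (λ i → c (suc i)) (λ i → b (suc i))

  InSpan : ∀ {k} → Vector V k → V → Set
  InSpan {k} b v = Σ (Fin k → F) λ c → v ≈v lincomb c b

  LinIndep : ∀ {k} → Vector V k → Set
  LinIndep {k} b = ∀ (c : Fin k → F) → lincomb c b ≈v 0v → ∀ i → c i ≡ 0#

  Proportional : V → V → Set
  Proportional u v = Σ F λ c → c ≢ 0# × v ≈v (c · u)

  -- sets of projective points (predicates on representing vectors)
  PointSet : Set₁
  PointSet = V → Set

  PointSetIn : ∀ {k} → Vector V k → PointSet → Set
  PointSetIn b S = (∀ v → S v → NonZeroV v × InSpan b v)
                 × (∀ u v → S u → Proportional u v → S v)

  _⊆_ : PointSet → PointSet → Set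
  S ⊆ T = ∀ v → S v → T v

  -- the plane is given by a basis π of 3 independent vectors;
  -- its lines are spans of 2 independent vectors of the plane
  IsBlockingSet : Vector V 3 → PointSet → Set
  IsBlockingSet π S =
    PointSetIn π S ×
    (∀ u w → InSpan π u → InSpan π w → LinIndep (u ∷ w ∷ []) →
       Σ V λ v → S v × InSpan (u ∷ w ∷ []) v)

  IsMinimalBlockingSet : Vector V 3 → PointSet → Set₁
  IsMinimalBlockingSet π S =
    IsBlockingSet π S × (∀ S′ → S′ ⊆ S → IsBlockingSet π S′ → S ⊆ S′)

  HasSize : PointSet → ℕ → Set
  HasSize S n = Σ (Fin n → V) λ L →
      (∀ i → S (L i))
    × (∀ i j → Proportional (L i) (L j) → i ≡ j)
    × (∀ v → S v → Σ (Fin n) λ i → Proportional (L i) v)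

  -- small: fewer than 3(q+1)/2 points, i.e. 2·|S| < 3(q+1)
  IsSmall : PointSet → Set
  IsSmall S = Σ ℕ λ n → HasSize S n × 2 *ℕ n < 3 *ℕ (q +ℕ 1)

  Cone : ∀ {s} → Vector V s → PointSet → PointSet
  Cone Ω B v = NonZeroV v × Σ V λ p → B p × InSpan (p ∷ Ω) v

  Meet : ∀ {k} → PointSet → Vector V k → PointSet
  Meet S b v = S v × InSpan b v

  IsWholePlane : Vector V 3 → PointSet → Set
  IsWholePlane π S = ∀ v → NonZeroV v → InSpan π v → S v

  IsUnionOfLinesThroughPoint : Vector V 3 → PointSet → Set₁
  IsUnionOfLinesThroughPoint π S =
    Σ V λ P → NonZeroV P × InSpan π P ×
    Σ PointSet λ D →
      (∀ d → D d → NonZeroV d × InSpan π d × ¬ Proportional P d)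
    × (∀ v → S v ⇔ (NonZeroV v × Σ V λ d → D d × InSpan (P ∷ d ∷ []) v))

  -- S ⊆ π is projectively equivalent to B ⊆ Γ: some projectivity Γ → π
  -- (the linear map sending the basis Γ to a basis h of π) maps B onto S
  ProjectivelyEquivalent : Vector V 3 → PointSet → Vector V 3 → PointSet → Set
  ProjectivelyEquivalent Γ B π S =
    Σ (Vector V 3) λ h → LinIndep h × (∀ i → InSpan π (h i)) ×
      (∀ (c : Fin 3 → F) → ¬ (∀ i → c i ≡ 0#) → B (lincomb c Γ) ⇔ S (lincomb c h))

module Submission where

-- A point ω + γ of Π (ω ∈ ⟨Ω⟩, γ ∈ ⟨Γ⟩) lies on K iff γ ∈ B or γ = 0, so
-- the section S = K ∩ π of a plane π ⊆ Π is governed by the projection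
-- from ⟨Ω⟩ of π onto Γ, a linear map given by a 3×3 matrix M (the
-- Γ-coordinates of a basis of π).  Either
--   * M is singular: some point P of π projects to 0, and S is the union of
--     the lines joining P to the points of S (this includes S = π); or
--   * M is invertible (via the adjugate, built from cross products): the
--     projection is a collineation π → Γ mapping S onto B, so S is a minimal
--     blocking set of π projectively equivalent to B.

open import Defs
open import Level using (0ℓ)
open import Data.Nat using (ℕ; zero; suc; _≤_; _∸_) renaming (_+_ to _+ℕ_)
open import Data.Fin using (Fin; zero; suc; _↑ˡ_; _↑ʳ_; splitAt; punchIn)
open import Data.Fin.Properties using (any?; all?; inj⇒≟; ¬∀⟶∃¬; punchInᵢ≢i; punchIn-injective)
open import Data.Product using (Σ; ∃; _×_; _,_; proj₁; proj₂)
open import Data.Sum using (_⊎_; inj₁; inj₂)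
open import Data.Empty using (⊥; ⊥-elim)
open import Data.Vec.Functional using (Vector; _++_; _∷_; [])
open import Relation.Nullary using (¬_; Dec; yes; no)
open import Relation.Nullary.Decidable using (map′; ¬?; _×-dec_)
open import Relation.Binary.PropositionalEquality
open import Function.Base using (_∘_)
open import Algebra.Bundles using (CommutativeRing)
open import Function.Bundles using (Inverse; Equivalence; _⇔_; mk⇔)
open import Function.Properties.Inverse using (↔⇒↣)
import Algebra.Solver.Ring.NaturalCoefficients.Default

pattern 0F = zero
pattern 1F = suc zero
pattern 2F = suc (suc zero)

module FieldFacts {q : ℕ} (𝔽 : FiniteField q) where
  open FiniteField 𝔽 public using (F; 0≢1; enumeration)

  ring : CommutativeRing 0ℓ 0ℓ
  ring = record { isCommutativeRing = FiniteField.isCommutativeRing 𝔽 }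

  open CommutativeRing ring public
    using (_+_; _*_; -_; _-_; 0#; 1#; +-comm; +-assoc; *-comm; *-assoc;
           +-identityˡ; +-identityʳ; *-identityˡ; *-identityʳ; zeroˡ; zeroʳ;
           distribˡ; distribʳ; -‿inverseʳ; commutativeSemiring)
  open import Algebra.Properties.Ring (CommutativeRing.ring ring) public
    using (-‿distribˡ-*; -0#≈0#; -‿involutive)
  open import Algebra.Properties.AbelianGroup (CommutativeRing.+-abelianGroup ring) public
    using (⁻¹-∙-comm)
  open import Algebra.Properties.Group (CommutativeRing.+-group ring) public
    using (x∙y⁻¹≈ε⇒x≈y)
  open import Algebra.Properties.CommutativeSemigroup (CommutativeRing.+-commutativeSemigroup ring) public
    using (interchange)

  module Semiring = Algebra.Solver.Ring.NaturalCoefficients.Default commutativeSemiring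

  _≟_ : (x y : F) → Dec (x ≡ y)
  _≟_ = inj⇒≟ (↔⇒↣ enumeration)

  search : {P : F → Set} → (∀ x → Dec (P x)) → Dec (Σ F P)
  search {P} P? = map′ from-Fin to-Fin (any? (λ i → P? (from i)))
    where
    open Inverse enumeration using (to; from; inverseʳ)
    from-Fin : (∃ λ i → P (from i)) → Σ F P
    from-Fin (i , p) = from i , p
    to-Fin : Σ F P → ∃ λ i → P (from i)
    to-Fin (x , p) = to x , subst P (sym (inverseʳ refl)) p

  stable : ∀ {x y : F} → ¬ ¬ (x ≡ y) → x ≡ y
  stable {x} {y} ¬¬x≡y with x ≟ y
  ... | yes x≡y = x≡y
  ... | no x≢y = ⊥-elim (¬¬x≡y x≢y)

  1≢0 : 1# ≢ 0#
  1≢0 e = 0≢1 (sym e)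

  inv : ∀ x → x ≢ 0# → F
  inv x x≢0 = proj₁ (FiniteField.inverse 𝔽 x x≢0)

  inv-inverseˡ : ∀ x (x≢0 : x ≢ 0#) → inv x x≢0 * x ≡ 1#
  inv-inverseˡ x x≢0 = trans (*-comm _ x) (proj₂ (FiniteField.inverse 𝔽 x x≢0))

  cancel-nonzero : ∀ {x y} → x ≢ 0# → x * y ≡ 0# → y ≡ 0#
  cancel-nonzero {x} {y} x≢0 xy≡0 = begin
    y                     ≡⟨ sym (*-identityˡ y) ⟩
    1# * y                ≡⟨ cong (_* y) (sym (inv-inverseˡ x x≢0)) ⟩
    (inv x x≢0 * x) * y   ≡⟨ *-assoc _ x y ⟩
    inv x x≢0 * (x * y)   ≡⟨ cong (inv x x≢0 *_) xy≡0 ⟩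
    inv x x≢0 * 0#        ≡⟨ zeroʳ _ ⟩
    0#                    ∎
    where open ≡-Reasoning

  nonzero-product : ∀ {x y} → x ≢ 0# → y ≢ 0# → x * y ≢ 0#
  nonzero-product x≢0 y≢0 xy≡0 = y≢0 (cancel-nonzero x≢0 xy≡0)

  difference-zero : ∀ x y → x - y ≡ 0# → x ≡ y
  difference-zero = x∙y⁻¹≈ε⇒x≈y

  zero-difference : ∀ {x y} → x ≡ y → x - y ≡ 0#
  zero-difference {x} {y} refl = -‿inverseʳ x

  δ : ∀ {k} → Fin k → Fin k → F
  δ zero    zero    = 1#
  δ zero    (suc _) = 0#
  δ (suc _) zero    = 0#
  δ (suc i) (suc j) = δ i j

  δ-diagonal : ∀ {k} (i : Fin k) → δ i i ≡ 1#
  δ-diagonal zero    = refl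
  δ-diagonal (suc i) = δ-diagonal i

  δ-off-diagonal : ∀ {k} {i j : Fin k} → i ≢ j → δ i j ≡ 0#
  δ-off-diagonal {i = zero}  {zero}  i≢j = ⊥-elim (i≢j refl)
  δ-off-diagonal {i = zero}  {suc j} i≢j = refl
  δ-off-diagonal {i = suc i} {zero}  i≢j = refl
  δ-off-diagonal {i = suc i} {suc j} i≢j = δ-off-diagonal (λ i≡j → i≢j (cong suc i≡j))

  rearrange : ∀ {a b c d} → a + b ≡ c + d → b - d ≡ c - a
  rearrange {a} {b} {c} {d} e = begin
    b - d                    ≡⟨ sym (+-identityʳ _) ⟩
    (b - d) + 0#             ≡⟨ cong ((b - d) +_) (sym (-‿inverseʳ a)) ⟩
    (b - d) + (a - a)        ≡⟨ solve 4 (λ a b nd na → (b :+ nd) :+ (a :+ na) := (a :+ b) :+ (nd :+ na))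
                                      refl a b (- d) (- a) ⟩
    (a + b) + (- d + - a)    ≡⟨ cong (_+ (- d + - a)) e ⟩
    (c + d) + (- d + - a)    ≡⟨ solve 4 (λ c d nd na → (c :+ d) :+ (nd :+ na) := (c :+ na) :+ (d :+ nd))
                                      refl c d (- d) (- a) ⟩
    (c - a) + (d - d)        ≡⟨ cong ((c - a) +_) (-‿inverseʳ d) ⟩
    (c - a) + 0#             ≡⟨ +-identityʳ _ ⟩
    c - a                    ∎
    where
    open ≡-Reasoning
    open Semiring using (solve; _:+_; _:=_)

module LinearAlgebra {q : ℕ} (𝔽 : FiniteField q) (n : ℕ) where
  open FieldFacts 𝔽
  open Geometry 𝔽 n

  ≈v-refl : ∀ {u} → u ≈v u
  ≈v-refl i = refl

  ≈v-sym : ∀ {u w} → u ≈v w → w ≈v u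
  ≈v-sym e i = sym (e i)

  ≈v-trans : ∀ {u w z} → u ≈v w → w ≈v z → u ≈v z
  ≈v-trans e f i = trans (e i) (f i)

  +v-cong : ∀ {u u′ w w′} → u ≈v u′ → w ≈v w′ → (u +v w) ≈v (u′ +v w′)
  +v-cong e f i = cong₂ _+_ (e i) (f i)

  ·-cong : ∀ a {u w} → u ≈v w → (a · u) ≈v (a · w)
  ·-cong a e i = cong (a *_) (e i)

  lincomb-congˡ : ∀ {k} {c d : Fin k → F} (b : Vector V k) → (∀ i → c i ≡ d i) →
    lincomb c b ≈v lincomb d b
  lincomb-congˡ {zero}  b e x = refl
  lincomb-congˡ {suc k} b e x =
    cong₂ _+_ (cong (_* b zero x) (e zero)) (lincomb-congˡ (b ∘ suc) (e ∘ suc) x)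

  lincomb-congʳ : ∀ {k} (c : Fin k → F) {b b′ : Vector V k} → (∀ i → b i ≈v b′ i) →
    lincomb c b ≈v lincomb c b′
  lincomb-congʳ {zero}  c e x = refl
  lincomb-congʳ {suc k} c e x =
    cong₂ _+_ (cong (c zero *_) (e zero x)) (lincomb-congʳ (c ∘ suc) (e ∘ suc) x)

  lincomb-zero : ∀ {k} (b : Vector V k) → lincomb (λ _ → 0#) b ≈v 0v
  lincomb-zero {zero}  b x = refl
  lincomb-zero {suc k} b x =
    trans (cong₂ _+_ (zeroˡ _) (lincomb-zero (b ∘ suc) x)) (+-identityˡ 0#)

  lincomb-vanishing : ∀ {k} {c : Fin k → F} (b : Vector V k) → (∀ i → c i ≡ 0#) → lincomb c b ≈v 0v
  lincomb-vanishing b c≡0 = ≈v-trans (lincomb-congˡ b c≡0) (lincomb-zero b)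

  lincomb-+ : ∀ {k} (c d : Fin k → F) (b : Vector V k) →
    lincomb (λ i → c i + d i) b ≈v (lincomb c b +v lincomb d b)
  lincomb-+ {zero}  c d b x = sym (+-identityˡ 0#)
  lincomb-+ {suc k} c d b x =
    trans (cong₂ _+_ (distribʳ _ _ _) (lincomb-+ (c ∘ suc) (d ∘ suc) (b ∘ suc) x))
          (interchange _ _ _ _)

  lincomb-· : ∀ {k} (a : F) (c : Fin k → F) (b : Vector V k) →
    lincomb (λ i → a * c i) b ≈v (a · lincomb c b)
  lincomb-· {zero}  a c b x = sym (zeroʳ a)
  lincomb-· {suc k} a c b x =
    trans (cong₂ _+_ (*-assoc a _ _) (lincomb-· a (c ∘ suc) (b ∘ suc) x)) (sym (distribˡ a _ _))

  lincomb-neg : ∀ {k} (c : Fin k → F) (b : Vector V k) →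
    ∀ x → lincomb (λ i → - c i) b x ≡ - lincomb c b x
  lincomb-neg {zero}  c b x = sym -0#≈0#
  lincomb-neg {suc k} c b x =
    trans (cong₂ _+_ (sym (-‿distribˡ-* _ _)) (lincomb-neg (c ∘ suc) (b ∘ suc) x)) (⁻¹-∙-comm _ _)

  lincomb-+v : ∀ {k} (c : Fin k → F) (b b′ : Vector V k) →
    lincomb c (λ i → b i +v b′ i) ≈v (lincomb c b +v lincomb c b′)
  lincomb-+v {zero}  c b b′ x = sym (+-identityˡ 0#)
  lincomb-+v {suc k} c b b′ x =
    trans (cong₂ _+_ (distribˡ _ _ _) (lincomb-+v (c ∘ suc) (b ∘ suc) (b′ ∘ suc) x))
          (interchange _ _ _ _)

  lincomb-lincomb : ∀ {k r} (c : Fin k → F) (R : Fin k → Fin r → F) (b : Vector V r) →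
    lincomb c (λ i → lincomb (R i) b) ≈v lincomb (Geometry.lincomb 𝔽 r c R) b
  lincomb-lincomb {zero}  c R b = ≈v-sym (lincomb-zero b)
  lincomb-lincomb {suc k} c R b =
    ≈v-trans (+v-cong (≈v-sym (lincomb-· (c zero) (R zero) b))
                      (lincomb-lincomb (c ∘ suc) (R ∘ suc) b))
             (≈v-sym (lincomb-+ _ _ b))

  lincomb-δ : ∀ {k} (j : Fin k) (b : Vector V k) → lincomb (δ j) b ≈v b j
  lincomb-δ {suc k} zero b x =
    trans (cong₂ _+_ (*-identityˡ _) (lincomb-zero (b ∘ suc) x)) (+-identityʳ _)
  lincomb-δ {suc k} (suc j) b x =
    trans (cong₂ _+_ (zeroˡ _) (lincomb-δ j (b ∘ suc) x)) (+-identityˡ _)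

  units-independent : ∀ {j l : Fin n} → j ≢ l → LinIndep (δ j ∷ δ l ∷ [])
  units-independent {j} {l} j≢l γ γδ≡0 = λ
    { 0F → trans (solve 2 (λ a b → a := a :* con 1 :+ (b :* con 0 :+ con 0)) refl (γ 0F) (γ 1F))
                 (value-at j (δ-diagonal j) (δ-off-diagonal (j≢l ∘ sym)))
    ; 1F → trans (solve 2 (λ a b → b := a :* con 0 :+ (b :* con 1 :+ con 0)) refl (γ 0F) (γ 1F))
                 (value-at l (δ-off-diagonal j≢l) (δ-diagonal l)) }
    where
    open Semiring using (solve; _:+_; _:*_; _:=_; con)
    value-at : ∀ x {α β} → δ j x ≡ α → δ l x ≡ β → γ 0F * α + (γ 1F * β + 0#) ≡ 0#
    value-at x refl refl = γδ≡0 x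

  lincomb-++ : ∀ {s r} (c : Fin (s +ℕ r) → F) (Ω : Vector V s) (Γ : Vector V r) →
    lincomb c (Ω ++ Γ) ≈v (lincomb (λ i → c (i ↑ˡ r)) Ω +v lincomb (λ i → c (s ↑ʳ i)) Γ)
  lincomb-++ {zero}      c Ω Γ x = sym (+-identityˡ _)
  lincomb-++ {suc s} {r} c Ω Γ x = begin
    c zero * Ω zero x + lincomb (c ∘ suc) ((Ω ++ Γ) ∘ suc) x
      ≡⟨ cong (c zero * Ω zero x +_) (lincomb-congʳ (c ∘ suc) tail x) ⟩
    c zero * Ω zero x + lincomb (c ∘ suc) ((Ω ∘ suc) ++ Γ) x
      ≡⟨ cong (c zero * Ω zero x +_) (lincomb-++ (c ∘ suc) (Ω ∘ suc) Γ x) ⟩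
    c zero * Ω zero x + (lincomb (λ i → c (suc (i ↑ˡ r))) (Ω ∘ suc) x
                         + lincomb (λ i → c (suc (s ↑ʳ i))) Γ x)
      ≡⟨ sym (+-assoc _ _ _) ⟩
    (c zero * Ω zero x + lincomb (λ i → c (suc (i ↑ˡ r))) (Ω ∘ suc) x)
      + lincomb (λ i → c (suc (s ↑ʳ i))) Γ x ∎
    where
    open ≡-Reasoning
    tail : ∀ i → (Ω ++ Γ) (suc i) ≈v ((Ω ∘ suc) ++ Γ) i
    tail i y with splitAt s i
    ... | inj₁ _ = refl
    ... | inj₂ _ = refl

  coordinates-unique : ∀ {k} (b : Vector V k) → LinIndep b → ∀ {c d} →
    lincomb c b ≈v lincomb d b → ∀ i → c i ≡ d i
  coordinates-unique b indep {c} {d} e =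
    λ i → difference-zero _ _ (indep (λ j → c j - d j) vanishes i)
    where
    vanishes : lincomb (λ j → c j - d j) b ≈v 0v
    vanishes x = begin
      lincomb (λ j → c j - d j) b x               ≡⟨ lincomb-+ c (λ j → - d j) b x ⟩
      lincomb c b x + lincomb (λ j → - d j) b x   ≡⟨ cong₂ _+_ (e x) (lincomb-neg d b x) ⟩
      lincomb d b x - lincomb d b x               ≡⟨ -‿inverseʳ _ ⟩
      0#                                          ∎
      where open ≡-Reasoning

  span-≈ : ∀ {k} {b : Vector V k} {u v} → InSpan b u → u ≈v v → InSpan b v
  span-≈ (c , e) f = c , ≈v-trans (≈v-sym f) e

  span-· : ∀ {k} {b : Vector V k} a {u} → InSpan b u → InSpan b (a · u)
  span-· {b = b} a (c , e) = (λ i → a * c i) , ≈v-trans (·-cong a e) (≈v-sym (lincomb-· a c b))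

  span-proportional : ∀ {k} {b : Vector V k} {u v} → InSpan b u → Proportional u v → InSpan b v
  span-proportional su (a , _ , f) = span-≈ (span-· a su) (≈v-sym f)

  span-difference : ∀ {k} {b : Vector V k} {u w} → InSpan b u → InSpan b w →
    InSpan b (λ x → u x - w x)
  span-difference {b = b} (c , e) (d , f) = (λ i → c i - d i) , λ x → begin
    _ - _                                      ≡⟨ cong₂ _-_ (e x) (f x) ⟩
    lincomb c b x - lincomb d b x              ≡⟨ cong (_ +_) (sym (lincomb-neg d b x)) ⟩
    lincomb c b x + lincomb (λ i → - d i) b x  ≡⟨ sym (lincomb-+ c (λ i → - d i) b x) ⟩
    lincomb (λ i → c i - d i) b x              ∎
    where open ≡-Reasoning

  span-mono : ∀ {k r} {b : Vector V k} (b′ : Vector V r) → (∀ i → InSpan b′ (b i)) →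
    ∀ {v} → InSpan b v → InSpan b′ v
  span-mono {b = b} b′ b⊆b′ (c , e) =
    Geometry.lincomb 𝔽 _ c (λ i → proj₁ (b⊆b′ i)) ,
    ≈v-trans e (≈v-trans (lincomb-congʳ c (λ i → proj₂ (b⊆b′ i))) (lincomb-lincomb c _ b′))

  ≈⇒proportional : ∀ {u v} → u ≈v v → Proportional u v
  ≈⇒proportional e = 1# , 1≢0 , λ i → trans (sym (e i)) (sym (*-identityˡ _))

  nonzero-≈ : ∀ {u v} → NonZeroV u → u ≈v v → NonZeroV v
  nonzero-≈ u≢0 e v≈0 = u≢0 (≈v-trans e v≈0)

  nonzero-proportional : ∀ {u v} → NonZeroV u → Proportional u v → NonZeroV v
  nonzero-proportional u≢0 (a , a≢0 , f) v≈0 =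
    u≢0 (λ i → cancel-nonzero a≢0 (trans (sym (f i)) (v≈0 i)))

  ProportionallyClosed : PointSet → Set
  ProportionallyClosed S = ∀ u v → S u → Proportional u v → S v

  closed-≈ : ∀ {S} → ProportionallyClosed S → ∀ {u v} → S u → u ≈v v → S v
  closed-≈ closed su e = closed _ _ su (≈⇒proportional e)

  ≈v? : ∀ u w → Dec (u ≈v w)
  ≈v? u w = all? (λ i → u i ≟ w i)

  proportional? : ∀ u v → Dec (Proportional u v)
  proportional? u v = search (λ a → ¬? (a ≟ 0#) ×-dec ≈v? v (a · u))

  direct-sum-unique : ∀ {s r} {Ω : Vector V s} {Γ : Vector V r} →
    (∀ v → NonZeroV v → InSpan Ω v → InSpan Γ v → ⊥) →
    ∀ {ω ω′ γ γ′} → InSpan Ω ω → InSpan Ω ω′ → InSpan Γ γ → InSpan Γ γ′ →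
    (ω +v γ) ≈v (ω′ +v γ′) → γ ≈v γ′
  direct-sum-unique {Ω = Ω} disjoint {ω} {ω′} {γ} {γ′} ω∈ ω′∈ γ∈ γ′∈ e x =
    difference-zero _ _ (stable λ dₓ≢0 → disjoint d (λ d≡0 → dₓ≢0 (d≡0 x)) d∈Ω (span-difference γ∈ γ′∈))
    where
    d : V
    d y = γ y - γ′ y
    d∈Ω : InSpan Ω d
    d∈Ω = span-≈ (span-difference ω′∈ ω∈) (λ y → sym (rearrange (e y)))

-- A matrix M is given by its rows M i : F³, and c ↦ c·M is
-- Geometry.lincomb 𝔽 3 c M.  Using cross products of the columns (the
-- adjugate), either c·M = 0 for some c ≠ 0, or M has a left inverse.
module Matrix3 {q : ℕ} (𝔽 : FiniteField q) where
  open FieldFacts 𝔽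
  open Geometry 𝔽 3 using (lincomb; _≈v_; 0v; NonZeroV; LinIndep)
  open ≡-Reasoning

  Vec3 : Set
  Vec3 = Fin 3 → F

  _∙_ : Vec3 → Vec3 → F
  u ∙ v = u 0F * v 0F + (u 1F * v 1F + (u 2F * v 2F + 0#))

  column : (Fin 3 → Vec3) → Fin 3 → Vec3
  column M x i = M i x

  _⨯⁺_ _⨯⁻_ _⨯_ : Vec3 → Vec3 → Vec3
  a ⨯⁺ b = a 1F * b 2F ∷ a 2F * b 0F ∷ a 0F * b 1F ∷ []
  a ⨯⁻ b = a 2F * b 1F ∷ a 0F * b 2F ∷ a 1F * b 0F ∷ []
  (a ⨯ b) i = (a ⨯⁺ b) i - (a ⨯⁻ b) i

  -- The semiring solver knows no negation, so differences are pulled out of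
  -- dot products; an identity with subtraction then splits into two
  -- semiring identities, one for each sign.
  difference-product : ∀ a b c → (a - b) * c ≡ a * c - b * c
  difference-product a b c = trans (distribʳ c a (- b)) (cong (a * c +_) (sym (-‿distribˡ-* b c)))

  difference-sum : ∀ a b c d → (a - b) + (c - d) ≡ (a + c) - (b + d)
  difference-sum a b c d = trans (interchange a (- b) c (- d)) (cong ((a + c) +_) (⁻¹-∙-comm b d))

  difference-sum₃ : ∀ x₀ y₀ x₁ y₁ x₂ y₂ →
    (x₀ - y₀) + ((x₁ - y₁) + ((x₂ - y₂) + 0#)) ≡ (x₀ + (x₁ + (x₂ + 0#))) - (y₀ + (y₁ + (y₂ + 0#)))
  difference-sum₃ x₀ y₀ x₁ y₁ x₂ y₂ = begin
    (x₀ - y₀) + ((x₁ - y₁) + ((x₂ - y₂) + 0#))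
      ≡⟨ cong (λ t → (x₀ - y₀) + ((x₁ - y₁) + ((x₂ - y₂) + t))) (sym (-‿inverseʳ 0#)) ⟩
    (x₀ - y₀) + ((x₁ - y₁) + ((x₂ - y₂) + (0# - 0#)))
      ≡⟨ cong (λ t → (x₀ - y₀) + ((x₁ - y₁) + t)) (difference-sum x₂ y₂ 0# 0#) ⟩
    (x₀ - y₀) + ((x₁ - y₁) + ((x₂ + 0#) - (y₂ + 0#)))
      ≡⟨ cong ((x₀ - y₀) +_) (difference-sum x₁ y₁ _ _) ⟩
    (x₀ - y₀) + ((x₁ + (x₂ + 0#)) - (y₁ + (y₂ + 0#)))
      ≡⟨ difference-sum x₀ y₀ _ _ ⟩
    (x₀ + (x₁ + (x₂ + 0#))) - (y₀ + (y₁ + (y₂ + 0#))) ∎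

  ∙-difference : ∀ (p n c : Vec3) → (λ i → p i - n i) ∙ c ≡ p ∙ c - n ∙ c
  ∙-difference p n c =
    trans (cong₂ _+_ (difference-product _ _ _)
            (cong₂ _+_ (difference-product _ _ _)
              (cong (_+ 0#) (difference-product _ _ _))))
          (difference-sum₃ _ _ _ _ _ _)

  ∙-scale : ∀ a (u v : Vec3) → (λ i → a * u i) ∙ v ≡ a * (u ∙ v)
  ∙-scale a u v = Semiring.solve 7
    (λ a u0 u1 u2 v0 v1 v2 →
      (a :* u0) :* v0 :+ ((a :* u1) :* v1 :+ ((a :* u2) :* v2 :+ con 0)) :=
      a :* (u0 :* v0 :+ (u1 :* v1 :+ (u2 :* v2 :+ con 0))))
    refl a (u 0F) (u 1F) (u 2F) (v 0F) (v 1F) (v 2F)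
    where open Semiring

  ⨯-orthogonalˡ : ∀ a b → (a ⨯ b) ∙ a ≡ 0#
  ⨯-orthogonalˡ a b = trans (∙-difference (a ⨯⁺ b) (a ⨯⁻ b) a) (zero-difference (Semiring.solve 6
    (λ a0 a1 a2 b0 b1 b2 →
      (a1 :* b2) :* a0 :+ ((a2 :* b0) :* a1 :+ ((a0 :* b1) :* a2 :+ con 0)) :=
      (a2 :* b1) :* a0 :+ ((a0 :* b2) :* a1 :+ ((a1 :* b0) :* a2 :+ con 0)))
    refl (a 0F) (a 1F) (a 2F) (b 0F) (b 1F) (b 2F)))
    where open Semiring

  ⨯-orthogonalʳ : ∀ a b → (a ⨯ b) ∙ b ≡ 0#
  ⨯-orthogonalʳ a b = trans (∙-difference (a ⨯⁺ b) (a ⨯⁻ b) b) (zero-difference (Semiring.solve 6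
    (λ a0 a1 a2 b0 b1 b2 →
      (a1 :* b2) :* b0 :+ ((a2 :* b0) :* b1 :+ ((a0 :* b1) :* b2 :+ con 0)) :=
      (a2 :* b1) :* b0 :+ ((a0 :* b2) :* b1 :+ ((a1 :* b0) :* b2 :+ con 0)))
    refl (a 0F) (a 1F) (a 2F) (b 0F) (b 1F) (b 2F)))
    where open Semiring

  ⨯-cyclic : ∀ a b c → (a ⨯ b) ∙ c ≡ (b ⨯ c) ∙ a
  ⨯-cyclic a b c = begin
    (a ⨯ b) ∙ c                          ≡⟨ ∙-difference (a ⨯⁺ b) (a ⨯⁻ b) c ⟩
    (a ⨯⁺ b) ∙ c - (a ⨯⁻ b) ∙ c          ≡⟨ cong₂ _-_ positive negative ⟩
    (b ⨯⁺ c) ∙ a - (b ⨯⁻ c) ∙ a          ≡⟨ sym (∙-difference (b ⨯⁺ c) (b ⨯⁻ c) a) ⟩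
    (b ⨯ c) ∙ a                          ∎
    where
    open Semiring using (solve; _:+_; _:*_; _:=_; con)
    positive : (a ⨯⁺ b) ∙ c ≡ (b ⨯⁺ c) ∙ a
    positive = solve 9
      (λ a0 a1 a2 b0 b1 b2 c0 c1 c2 →
        (a1 :* b2) :* c0 :+ ((a2 :* b0) :* c1 :+ ((a0 :* b1) :* c2 :+ con 0)) :=
        (b1 :* c2) :* a0 :+ ((b2 :* c0) :* a1 :+ ((b0 :* c1) :* a2 :+ con 0)))
      refl (a 0F) (a 1F) (a 2F) (b 0F) (b 1F) (b 2F) (c 0F) (c 1F) (c 2F)
    negative : (a ⨯⁻ b) ∙ c ≡ (b ⨯⁻ c) ∙ a
    negative = solve 9
      (λ a0 a1 a2 b0 b1 b2 c0 c1 c2 →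
        (a2 :* b1) :* c0 :+ ((a0 :* b2) :* c1 :+ ((a1 :* b0) :* c2 :+ con 0)) :=
        (b2 :* c1) :* a0 :+ ((b0 :* c2) :* a1 :+ ((b1 :* c0) :* a2 :+ con 0)))
      refl (a 0F) (a 1F) (a 2F) (b 0F) (b 1F) (b 2F) (c 0F) (c 1F) (c 2F)

  det : (Fin 3 → Vec3) → F
  det M = (column M 1F ⨯ column M 2F) ∙ column M 0F

  next : Fin 3 → Fin 3
  next 0F = 1F
  next 1F = 2F
  next 2F = 0F

  adjugate : (Fin 3 → Vec3) → Fin 3 → Vec3
  adjugate M j = column M (next j) ⨯ column M (next (next j))

  adjugate-law : ∀ M j x → adjugate M j ∙ column M x ≡ δ j x * det M
  adjugate-law M 0F 0F = sym (*-identityˡ _)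
  adjugate-law M 0F 1F = trans (⨯-orthogonalˡ (column M 1F) (column M 2F)) (sym (zeroˡ _))
  adjugate-law M 0F 2F = trans (⨯-orthogonalʳ (column M 1F) (column M 2F)) (sym (zeroˡ _))
  adjugate-law M 1F 0F = trans (⨯-orthogonalʳ (column M 2F) (column M 0F)) (sym (zeroˡ _))
  adjugate-law M 1F 1F = trans (sym (⨯-cyclic (column M 1F) (column M 2F) (column M 0F)))
                               (sym (*-identityˡ _))
  adjugate-law M 1F 2F = trans (⨯-orthogonalˡ (column M 2F) (column M 0F)) (sym (zeroˡ _))
  adjugate-law M 2F 0F = trans (⨯-orthogonalˡ (column M 0F) (column M 1F)) (sym (zeroˡ _))
  adjugate-law M 2F 1F = trans (⨯-orthogonalʳ (column M 0F) (column M 1F)) (sym (zeroˡ _))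
  adjugate-law M 2F 2F = trans (⨯-cyclic (column M 0F) (column M 1F) (column M 2F))
                               (sym (*-identityˡ _))

  Kernel : (Fin 3 → Vec3) → Set
  Kernel M = Σ Vec3 λ c → NonZeroV c × lincomb c M ≈v 0v

  kernel? : ∀ M → Dec (Kernel M)
  kernel? M = map′ to-kernel from-kernel
    (search λ α → search λ β → search λ γ →
       ¬? (all? λ i → (α ∷ β ∷ γ ∷ []) i ≟ 0#) ×-dec all? λ x → lincomb (α ∷ β ∷ γ ∷ []) M x ≟ 0#)
    where
    KernelTriple : Set
    KernelTriple = Σ F λ α → Σ F λ β → Σ F λ γ →
      NonZeroV (α ∷ β ∷ γ ∷ []) × lincomb (α ∷ β ∷ γ ∷ []) M ≈v 0v
    to-kernel : KernelTriple → Kernel M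
    to-kernel (α , β , γ , c≢0 , cM≡0) = (α ∷ β ∷ γ ∷ []) , c≢0 , cM≡0
    from-kernel : Kernel M → KernelTriple
    from-kernel (c , c≢0 , cM≡0) =
      c 0F , c 1F , c 2F , (λ c≡0 → c≢0 λ { 0F → c≡0 0F ; 1F → c≡0 1F ; 2F → c≡0 2F }) , cM≡0

  dependent-rows : ∀ M → (∀ s x → M 0F s * M 1F x ≡ M 1F s * M 0F x) → Kernel M
  dependent-rows M minors with all? (λ x → M 0F x ≟ 0#)
  ... | yes row₀≡0 = (1# ∷ 0# ∷ 0# ∷ []) , (λ c≡0 → 1≢0 (c≡0 0F)) , λ x → begin
    1# * M 0F x + (0# * M 1F x + (0# * M 2F x + 0#))
      ≡⟨ cong₂ _+_ (*-identityˡ _) (cong₂ _+_ (zeroˡ _) (trans (+-identityʳ _) (zeroˡ _))) ⟩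
    M 0F x + (0# + 0#)  ≡⟨ cong₂ _+_ (row₀≡0 x) (+-identityʳ 0#) ⟩
    0# + 0#             ≡⟨ +-identityʳ 0# ⟩
    0#                  ∎
  ... | no row₀≢0 with ¬∀⟶∃¬ 3 _ (λ x → M 0F x ≟ 0#) row₀≢0
  ... | s , M₀ₛ≢0 = (M 1F s ∷ - M 0F s ∷ 0# ∷ []) , c≢0 , λ x → begin
    M 1F s * M 0F x + (- M 0F s * M 1F x + (0# * M 2F x + 0#))
      ≡⟨ cong (M 1F s * M 0F x +_) (cong₂ _+_ (sym (-‿distribˡ-* _ _)) (trans (+-identityʳ _) (zeroˡ _))) ⟩
    M 1F s * M 0F x + (- (M 0F s * M 1F x) + 0#)
      ≡⟨ cong (M 1F s * M 0F x +_) (trans (+-identityʳ _) (cong -_ (minors s x))) ⟩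
    M 1F s * M 0F x - M 1F s * M 0F x
      ≡⟨ -‿inverseʳ _ ⟩
    0# ∎
    where
    c≢0 : NonZeroV (M 1F s ∷ - M 0F s ∷ 0# ∷ [])
    c≢0 c≡0 = M₀ₛ≢0 (trans (sym (-‿involutive _)) (trans (cong -_ (c≡0 1F)) -0#≈0#))

  -- det M = 0 forces a relation between the rows: either some row of the
  -- adjugate is nonzero (and it annihilates M), or all 2×2 minors vanish.
  singular-has-kernel : ∀ M → det M ≡ 0# → Kernel M
  singular-has-kernel M det≡0 with all? (λ j → all? (λ i → adjugate M j i ≟ 0#))
  ... | no adj≢0 with ¬∀⟶∃¬ 3 _ (λ j → all? (λ i → adjugate M j i ≟ 0#)) adj≢0
  ... | j , row≢0 = adjugate M j , row≢0 , λ x →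
    trans (adjugate-law M j x) (trans (cong (δ j x *_) det≡0) (zeroʳ _))
  singular-has-kernel M det≡0 | yes adj≡0 = dependent-rows M minors
    where
    minor : ∀ j → M 0F (next j) * M 1F (next (next j)) ≡ M 1F (next j) * M 0F (next (next j))
    minor j = difference-zero _ _ (adj≡0 j 2F)
    swapped : ∀ {a b c d} → a * b ≡ c * d → d * c ≡ b * a
    swapped {a} {b} {c} {d} e = trans (*-comm d c) (trans (sym e) (*-comm a b))
    minors : ∀ s x → M 0F s * M 1F x ≡ M 1F s * M 0F x
    minors 0F 0F = *-comm _ _
    minors 1F 1F = *-comm _ _
    minors 2F 2F = *-comm _ _
    minors 1F 2F = minor 0F
    minors 2F 0F = minor 1F
    minors 0F 1F = minor 2F
    minors 2F 1F = swapped (minor 0F)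
    minors 0F 2F = swapped (minor 1F)
    minors 1F 0F = swapped (minor 2F)

  adjugate-inverse : ∀ M → det M ≢ 0# → Σ (Fin 3 → Vec3) λ N → ∀ j → lincomb (N j) M ≈v δ j
  adjugate-inverse M det≢0 = N , λ j x → begin
    (λ i → d⁻¹ * adjugate M j i) ∙ column M x   ≡⟨ ∙-scale d⁻¹ (adjugate M j) (column M x) ⟩
    d⁻¹ * (adjugate M j ∙ column M x)           ≡⟨ cong (d⁻¹ *_) (adjugate-law M j x) ⟩
    d⁻¹ * (δ j x * det M)                       ≡⟨ cong (d⁻¹ *_) (*-comm _ _) ⟩
    d⁻¹ * (det M * δ j x)                       ≡⟨ sym (*-assoc _ _ _) ⟩
    (d⁻¹ * det M) * δ j x                       ≡⟨ cong (_* δ j x) (inv-inverseˡ _ det≢0) ⟩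
    1# * δ j x                                  ≡⟨ *-identityˡ _ ⟩
    δ j x                                       ∎
    where
    d⁻¹ : F
    d⁻¹ = inv (det M) det≢0
    N : Fin 3 → Vec3
    N j i = d⁻¹ * adjugate M j i

  kernel-or-inverse : ∀ M → Kernel M ⊎ (LinIndep M × Σ (Fin 3 → Vec3) λ N → ∀ j → lincomb (N j) M ≈v δ j)
  kernel-or-inverse M with kernel? M | det M ≟ 0#
  ... | yes ker | _          = inj₁ ker
  ... | no ¬ker | yes det≡0 = ⊥-elim (¬ker (singular-has-kernel M det≡0))
  ... | no ¬ker | no det≢0  = inj₂ (independent , adjugate-inverse M det≢0)
    where
    independent : LinIndep M
    independent c cM≡0 i = stable λ cᵢ≢0 → ¬ker (c , (λ c≡0 → cᵢ≢0 (c≡0 i)) , cM≡0)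

module PlaneGeometry {q : ℕ} (𝔽 : FiniteField q) (m : ℕ) where
  open FieldFacts 𝔽
  open Geometry 𝔽 m
  open LinearAlgebra 𝔽 m
  module G₃ = Geometry 𝔽 3

  pair-coordinates : ∀ (X : Vector V 3) a b →
    LinIndep (lincomb a X ∷ lincomb b X ∷ []) → G₃.LinIndep (a ∷ b ∷ [])
  pair-coordinates X a b independent γ γab≡0 =
    independent γ (≈v-trans (lincomb-lincomb γ (a ∷ b ∷ []) X) (lincomb-vanishing X γab≡0))

  pair-images : ∀ (X : Vector V 3) → LinIndep X → ∀ {a b} →
    G₃.LinIndep (a ∷ b ∷ []) → LinIndep (lincomb a X ∷ lincomb b X ∷ [])
  pair-images X X-independent {a} {b} ab-independent γ γ·images≡0 =
    ab-independent γ (X-independent _ (≈v-trans (≈v-sym (lincomb-lincomb γ (a ∷ b ∷ []) X)) γ·images≡0))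

  pair-≈ : ∀ {u u′ w w′} → u ≈v u′ → w ≈v w′ →
    LinIndep (u ∷ w ∷ []) → LinIndep (u′ ∷ w′ ∷ [])
  pair-≈ {u} {u′} {w} {w′} u≈ w≈ independent γ z =
    independent γ (≈v-trans (lincomb-congʳ γ {u ∷ w ∷ []} {u′ ∷ w′ ∷ []} λ { 0F → u≈ ; 1F → w≈ }) z)

  Corresponds : Vector V 3 → PointSet → Vector V 3 → PointSet → Set
  Corresponds X SX Y SY =
    ∀ (c : Fin 3 → F) → ¬ (∀ i → c i ≡ 0#) → SX (lincomb c X) ⇔ SY (lincomb c Y)

  -- The image of a blocking set under a collineation is a blocking set: a line
  -- ⟨u, w⟩ of ⟨Y⟩ comes from the line of ⟨X⟩ with the same coordinates.
  transfer-blocking : ∀ X SX Y SY → LinIndep X → PointSetIn Y SY →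
    Corresponds X SX Y SY → IsBlockingSet X SX → IsBlockingSet Y SY
  transfer-blocking X SX Y SY X-independent SY-in corr (SX-in , SX-blocks) = SY-in , blocks
    where
    blocks : ∀ u w → InSpan Y u → InSpan Y w → LinIndep (u ∷ w ∷ []) →
      Σ V λ v → SY v × InSpan (u ∷ w ∷ []) v
    blocks u w (a , u≈aY) (b , w≈bY) uw-independent =
      lincomb c Y , Equivalence.to (corr c c≢0) (closed-≈ (proj₂ SX-in) p∈SX p≈cX) , γ , cY-on-line
      where
      ab-independent : G₃.LinIndep (a ∷ b ∷ [])
      ab-independent = pair-coordinates Y a b (pair-≈ u≈aY w≈bY uw-independent)
      hit : Σ V λ p → SX p × InSpan (lincomb a X ∷ lincomb b X ∷ []) p
      hit = SX-blocks (lincomb a X) (lincomb b X) (a , ≈v-refl) (b , ≈v-refl)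
                      (pair-images X X-independent ab-independent)
      p : V
      p = proj₁ hit
      p∈SX : SX p
      p∈SX = proj₁ (proj₂ hit)
      γ : Fin 2 → F
      γ = proj₁ (proj₂ (proj₂ hit))
      c : Fin 3 → F
      c = G₃.lincomb γ (a ∷ b ∷ [])
      p≈cX : p ≈v lincomb c X
      p≈cX = ≈v-trans (proj₂ (proj₂ (proj₂ hit))) (lincomb-lincomb γ (a ∷ b ∷ []) X)
      c≢0 : ¬ (∀ i → c i ≡ 0#)
      c≢0 c≡0 = proj₁ (proj₁ SX-in p p∈SX) (≈v-trans p≈cX (lincomb-vanishing X c≡0))
      cY-on-line : lincomb c Y ≈v lincomb γ (u ∷ w ∷ [])
      cY-on-line = ≈v-trans (≈v-sym (lincomb-lincomb γ (a ∷ b ∷ []) Y))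
                            (lincomb-congʳ γ {lincomb a Y ∷ lincomb b Y ∷ []} {u ∷ w ∷ []}
                              λ { 0F → ≈v-sym u≈aY ; 1F → ≈v-sym w≈bY })

  -- Minimality transfers too: a blocking subset S′ of SY pulls back to a
  -- blocking subset T of SX, which must be all of SX.
  transfer-minimal : ∀ X SX Y SY → LinIndep X → LinIndep Y → PointSetIn Y SY →
    Corresponds X SX Y SY → IsMinimalBlockingSet X SX → IsMinimalBlockingSet Y SY
  transfer-minimal X SX Y SY X-independent Y-independent SY-in corr (SX-blocking , SX-minimal) =
    transfer-blocking X SX Y SY X-independent SY-in corr SX-blocking , minimal
    where
    SX-in : PointSetIn X SX
    SX-in = proj₁ SX-blocking
    minimal : ∀ S′ → S′ ⊆ SY → IsBlockingSet Y S′ → SY ⊆ S′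
    minimal S′ S′⊆SY S′-blocking v v∈SY =
      closed-≈ (proj₂ S′-in) (pulled-back c (SX⊆T _ cX∈SX)) (≈v-sym v≈cY)
      where
      S′-in : PointSetIn Y S′
      S′-in = proj₁ S′-blocking
      T : PointSet
      T u = Σ (Fin 3 → F) λ c → u ≈v lincomb c X × S′ (lincomb c Y)
      coefficients-nonzero : ∀ {c} → NonZeroV (lincomb c Y) → ¬ (∀ i → c i ≡ 0#)
      coefficients-nonzero cY≢0 c≡0 = cY≢0 (lincomb-vanishing Y c≡0)
      pulled-back : ∀ c → T (lincomb c X) → S′ (lincomb c Y)
      pulled-back c (c′ , cX≈c′X , c′Y∈S′) =
        closed-≈ (proj₂ S′-in) c′Y∈S′
          (lincomb-congˡ Y λ i → sym (coordinates-unique X X-independent {c} {c′} cX≈c′X i))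
      T⊆SX : T ⊆ SX
      T⊆SX u (c , u≈cX , cY∈S′) =
        closed-≈ (proj₂ SX-in)
          (Equivalence.from (corr c (coefficients-nonzero (proj₁ (proj₁ S′-in _ cY∈S′))))
                            (S′⊆SY _ cY∈S′))
          (≈v-sym u≈cX)
      T-in : PointSetIn X T
      T-in = (λ u u∈T → proj₁ (proj₁ SX-in u (T⊆SX u u∈T)) , proj₁ u∈T , proj₁ (proj₂ u∈T)) ,
             λ { u v (c , u≈cX , cY∈S′) (a , a≢0 , v≈au) →
                   (λ i → a * c i) ,
                   ≈v-trans v≈au (≈v-trans (·-cong a u≈cX) (≈v-sym (lincomb-· a c X))) ,
                   proj₂ S′-in _ _ cY∈S′ (a , a≢0 , lincomb-· a c Y) }
      T-blocking : IsBlockingSet X T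
      T-blocking = transfer-blocking Y S′ X T Y-independent T-in
        (λ c c≢0 → mk⇔ (λ cY∈S′ → c , ≈v-refl , cY∈S′) (pulled-back c)) S′-blocking
      SX⊆T : SX ⊆ T
      SX⊆T = SX-minimal T T⊆SX T-blocking
      c : Fin 3 → F
      c = proj₁ (proj₂ (proj₁ SY-in v v∈SY))
      v≈cY : v ≈v lincomb c Y
      v≈cY = proj₂ (proj₂ (proj₁ SY-in v v∈SY))
      cX∈SX : SX (lincomb c X)
      cX∈SX = Equivalence.from (corr c (coefficients-nonzero (nonzero-≈ (proj₁ (proj₁ SY-in v v∈SY)) v≈cY)))
                               (closed-≈ (proj₂ SY-in) v∈SY v≈cY)

  same-plane-blocking : ∀ X Y S → (∀ i → InSpan Y (X i)) → (∀ i → InSpan X (Y i)) →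
    IsBlockingSet X S → IsBlockingSet Y S
  same-plane-blocking X Y S X⊆Y Y⊆X ((S-in , S-closed) , S-blocks) =
    ((λ v v∈S → proj₁ (S-in v v∈S) , span-mono Y X⊆Y (proj₂ (S-in v v∈S))) , S-closed) ,
    λ u w u∈Y w∈Y → S-blocks u w (span-mono X Y⊆X u∈Y) (span-mono X Y⊆X w∈Y)

  same-plane-minimal : ∀ X Y S → (∀ i → InSpan Y (X i)) → (∀ i → InSpan X (Y i)) →
    IsMinimalBlockingSet X S → IsMinimalBlockingSet Y S
  same-plane-minimal X Y S X⊆Y Y⊆X (S-blocking , S-minimal) =
    same-plane-blocking X Y S X⊆Y Y⊆X S-blocking ,
    λ S′ S′⊆S S′-blocking → S-minimal S′ S′⊆S (same-plane-blocking Y X S′ Y⊆X X⊆Y S′-blocking)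

  rebase-independent : ∀ X X′ Y (N : Fin 3 → Fin 3 → F) → LinIndep X′ → LinIndep Y →
    (∀ j → X′ j ≈v lincomb (N j) X) → LinIndep (λ j → lincomb (N j) Y)
  rebase-independent X X′ Y N X′-independent Y-independent X′≈NX c cNY≡0 =
    X′-independent c (≈v-trans (lincomb-congʳ c X′≈NX)
                     (≈v-trans (lincomb-lincomb c N X) (lincomb-vanishing X cN≡0)))
    where
    cN≡0 : ∀ i → G₃.lincomb c N i ≡ 0#
    cN≡0 = Y-independent _ (≈v-trans (≈v-sym (lincomb-lincomb c N Y)) cNY≡0)

  rebase-corresponds : ∀ X SX X′ Y SY (N : Fin 3 → Fin 3 → F) → LinIndep X′ →
    ProportionallyClosed SX → ProportionallyClosed SY → (∀ j → X′ j ≈v lincomb (N j) X) →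
    Corresponds X SX Y SY → Corresponds X′ SX (λ j → lincomb (N j) Y) SY
  rebase-corresponds X SX X′ Y SY N X′-independent SX-closed SY-closed X′≈NX corr c c≢0 =
    mk⇔ (λ s → closed-≈ SY-closed (Equivalence.to (corr cN cN≢0) (closed-≈ SX-closed s cX′≈cNX)) cNY≈)
        (λ s → closed-≈ SX-closed (Equivalence.from (corr cN cN≢0) (closed-≈ SY-closed s (≈v-sym cNY≈)))
                                  (≈v-sym cX′≈cNX))
    where
    cN : Fin 3 → F
    cN = G₃.lincomb c N
    cX′≈cNX : lincomb c X′ ≈v lincomb cN X
    cX′≈cNX = ≈v-trans (lincomb-congʳ c X′≈NX) (lincomb-lincomb c N X)
    cNY≈ : lincomb cN Y ≈v lincomb c (λ j → lincomb (N j) Y)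
    cNY≈ = ≈v-sym (lincomb-lincomb c N Y)
    cN≢0 : ¬ (∀ i → cN i ≡ 0#)
    cN≢0 cN≡0 = c≢0 (X′-independent c (≈v-trans cX′≈cNX (lincomb-vanishing X cN≡0)))

module ConeSection {q : ℕ} (𝔽 : FiniteField q) (m : ℕ) where
  open FieldFacts 𝔽
  open Geometry 𝔽 m
  open LinearAlgebra 𝔽 m
  open PlaneGeometry 𝔽 m
  module L₃ = LinearAlgebra 𝔽 3
  open Matrix3 𝔽 using (kernel-or-inverse)

  module _ {s : ℕ} (Ω : Vector V s) (Γ : Vector V 3) (Γ-independent : LinIndep Γ)
           (disjoint : ∀ v → NonZeroV v → InSpan Ω v → InSpan Γ v → ⊥)
           (B : PointSet) (B-minimal : IsMinimalBlockingSet Γ B) where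

    B-blocking : IsBlockingSet Γ B
    B-blocking = proj₁ B-minimal

    B-in : PointSetIn Γ B
    B-in = proj₁ B-blocking

    -- B is nonempty, since it meets the line ⟨Γ₀, Γ₁⟩.
    B-point : Σ V B
    B-point with proj₂ B-blocking (lincomb (δ 0F) Γ) (lincomb (δ 1F) Γ) (δ 0F , ≈v-refl) (δ 1F , ≈v-refl)
                   (pair-images Γ Γ-independent (L₃.units-independent {0F} {1F} λ ()))
    ... | p , p∈B , _ = p , p∈B

    cone-closed : ProportionallyClosed (Cone Ω B)
    cone-closed u v (u≢0 , p , p∈B , u∈⟨p,Ω⟩) u∝v =
      nonzero-proportional u≢0 u∝v , p , p∈B , span-proportional {b = p ∷ Ω} u∈⟨p,Ω⟩ u∝v

    -- For ω ∈ ⟨Ω⟩ and γ ∈ ⟨Γ⟩, the point ω + γ lies on the cone iff it is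
    -- nonzero and γ is a point of B or zero: a point w₀p + Σ w′Ω of ⟨p, Ω⟩
    -- has Γ-component w₀p, by uniqueness of the decomposition.
    cone⇒ : ∀ {ω γ} → InSpan Ω ω → InSpan Γ γ → Cone Ω B (ω +v γ) → B γ ⊎ γ ≈v 0v
    cone⇒ {γ = γ} ω∈Ω γ∈Γ (_ , p , p∈B , w , v≈) = classify (w 0F ≟ 0#)
      where
      γ≈w₀p : γ ≈v (w 0F · p)
      γ≈w₀p = direct-sum-unique {Ω = Ω} {Γ} disjoint ω∈Ω (w ∘ suc , ≈v-refl) γ∈Γ
                                (span-· {b = Γ} (w 0F) (proj₂ (proj₁ B-in p p∈B)))
                                (λ x → trans (v≈ x) (+-comm _ _))
      classify : Dec (w 0F ≡ 0#) → B γ ⊎ γ ≈v 0v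
      classify (yes w₀≡0) = inj₂ λ x → trans (γ≈w₀p x) (trans (cong (_* p x) w₀≡0) (zeroˡ _))
      classify (no w₀≢0)  = inj₁ (proj₂ B-in p γ p∈B (w 0F , w₀≢0 , γ≈w₀p))

    cone⇐ : ∀ {ω γ} → InSpan Ω ω → NonZeroV (ω +v γ) → B γ ⊎ γ ≈v 0v → Cone Ω B (ω +v γ)
    cone⇐ {γ = γ} (cω , ω≈) v≢0 (inj₁ γ∈B) =
      v≢0 , γ , γ∈B , (1# ∷ cω) , λ x → trans (+-comm _ _) (cong₂ _+_ (sym (*-identityˡ _)) (ω≈ x))
    cone⇐ {ω} {γ} (cω , ω≈) v≢0 (inj₂ γ≈0) =
      v≢0 , proj₁ B-point , proj₂ B-point , (0# ∷ cω) , λ x → begin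
        ω x + γ x                            ≡⟨ cong₂ _+_ (ω≈ x) (γ≈0 x) ⟩
        lincomb cω Ω x + 0#                  ≡⟨ +-comm _ 0# ⟩
        0# + lincomb cω Ω x                  ≡⟨ cong (_+ lincomb cω Ω x) (sym (zeroˡ _)) ⟩
        0# * proj₁ B-point x + lincomb cω Ω x ∎
      where open ≡-Reasoning

    module _ (π : Vector V 3) (π-independent : LinIndep π)
             (π-in : ∀ i → InSpan (Ω ++ Γ) (π i)) where

      -- Split each π i = ω i + G i along ⟨Ω⟩ ⊕ ⟨Γ⟩; G i = Σⱼ M i j Γ j is the
      -- projection of π i from ⟨Ω⟩ onto ⟨Γ⟩.
      M : Fin 3 → Fin 3 → F
      M i j = proj₁ (π-in i) (s ↑ʳ j)

      ω : Vector V 3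
      ω i = lincomb (λ j → proj₁ (π-in i) (j ↑ˡ 3)) Ω

      G : Vector V 3
      G i = lincomb (M i) Γ

      π-split : ∀ i → π i ≈v (ω i +v G i)
      π-split i = ≈v-trans (proj₂ (π-in i)) (lincomb-++ (proj₁ (π-in i)) Ω Γ)

      point shadow : (Fin 3 → F) → V
      point c = lincomb c π
      shadow c = lincomb c G

      point-split : ∀ c → point c ≈v (lincomb c ω +v shadow c)
      point-split c = ≈v-trans (lincomb-congʳ c π-split) (lincomb-+v c ω G)

      point-nonzero : ∀ c → ¬ (∀ i → c i ≡ 0#) → NonZeroV (point c)
      point-nonzero c c≢0 c·π≡0 = c≢0 (π-independent c c·π≡0)

      ω-part-in-Ω : ∀ c → InSpan Ω (lincomb c ω)
      ω-part-in-Ω c = span-mono {b = ω} Ω (λ i → _ , ≈v-refl) (c , ≈v-refl)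

      shadow-in-Γ : ∀ c → InSpan Γ (shadow c)
      shadow-in-Γ c = span-mono {b = G} Γ (λ i → M i , ≈v-refl) (c , ≈v-refl)

      S : PointSet
      S = Meet (Cone Ω B) π

      S-in : PointSetIn π S
      S-in = (λ { v (v∈K , v∈π) → proj₁ v∈K , v∈π }) ,
             λ { u v (u∈K , u∈π) u∝v → cone-closed u v u∈K u∝v , span-proportional {b = π} u∈π u∝v }

      section⇒ : ∀ c → S (point c) → B (shadow c) ⊎ shadow c ≈v 0v
      section⇒ c (c∈K , _) =
        cone⇒ (ω-part-in-Ω c) (shadow-in-Γ c) (closed-≈ cone-closed c∈K (point-split c))

      section⇐ : ∀ c → NonZeroV (point c) → B (shadow c) ⊎ shadow c ≈v 0v → S (point c)
      section⇐ c c≢0 shadow∈B∪0 =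
        closed-≈ cone-closed (cone⇐ (ω-part-in-Ω c) (nonzero-≈ c≢0 (point-split c)) shadow∈B∪0)
                             (≈v-sym (point-split c)) ,
        (c , ≈v-refl)

      section-rescale : ∀ c e β → S (point e) → NonZeroV (point c) →
        shadow c ≈v (β · shadow e) → S (point c)
      section-rescale c e β e∈S c≢0 c≈βe = section⇐ c c≢0 (rescaled (β ≟ 0#) (section⇒ e e∈S))
        where
        rescaled : Dec (β ≡ 0#) → B (shadow e) ⊎ shadow e ≈v 0v → B (shadow c) ⊎ shadow c ≈v 0v
        rescaled (yes β≡0) _             = inj₂ λ x → trans (c≈βe x) (trans (cong (_* _) β≡0) (zeroˡ _))
        rescaled (no β≢0)  (inj₁ e∈B)   = inj₁ (proj₂ B-in _ _ e∈B (β , β≢0 , c≈βe))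
        rescaled (no β≢0)  (inj₂ e≈0)   = inj₂ λ x → trans (c≈βe x) (trans (cong (β *_) (e≈0 x)) (zeroʳ β))

      -- S meets every line of π: the shadow of a line is either a line of ⟨Γ⟩,
      -- met by B, or some point of the line has zero shadow.
      section-meets-line : ∀ a b → G₃.LinIndep (a ∷ b ∷ []) →
        Σ (Fin 2 → F) λ γ → S (point (G₃.lincomb γ (a ∷ b ∷ [])))
      section-meets-line a b ab-independent = classify degenerate?
        where
        shadow-line : ∀ γ → lincomb γ (shadow a ∷ shadow b ∷ []) ≈v shadow (G₃.lincomb γ (a ∷ b ∷ []))
        shadow-line γ = lincomb-lincomb γ (a ∷ b ∷ []) G
        Degenerate : Set
        Degenerate = Σ F λ α → Σ F λ β → ¬ (α ≡ 0# × β ≡ 0#) ×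
                       lincomb (α ∷ β ∷ []) (shadow a ∷ shadow b ∷ []) ≈v 0v
        degenerate? : Dec Degenerate
        degenerate? = search λ α → search λ β → ¬? ((α ≟ 0#) ×-dec (β ≟ 0#)) ×-dec ≈v? _ 0v
        classify : Dec Degenerate → Σ (Fin 2 → F) λ γ → S (point (G₃.lincomb γ (a ∷ b ∷ [])))
        classify (yes (α , β , αβ≢0 , shadow≈0)) =
          (α ∷ β ∷ []) ,
          section⇐ c (point-nonzero c λ c≡0 → αβ≢0 (ab-independent (α ∷ β ∷ []) c≡0 0F ,
                                                     ab-independent (α ∷ β ∷ []) c≡0 1F))
                     (inj₂ (≈v-trans (≈v-sym (shadow-line (α ∷ β ∷ []))) shadow≈0))
          where
          c : Fin 3 → F
          c = G₃.lincomb (α ∷ β ∷ []) (a ∷ b ∷ [])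
        classify (no nondegenerate) = γ , section⇐ c c≢0 (inj₁ (closed-≈ (proj₂ B-in) p∈B p≈shadow))
          where
          shadows-independent : LinIndep (shadow a ∷ shadow b ∷ [])
          shadows-independent γ z 0F = stable λ γ₀≢0 → nondegenerate (γ 0F , γ 1F , γ₀≢0 ∘ proj₁ , z)
          shadows-independent γ z 1F = stable λ γ₁≢0 → nondegenerate (γ 0F , γ 1F , γ₁≢0 ∘ proj₂ , z)
          hit : Σ V λ p → B p × InSpan (shadow a ∷ shadow b ∷ []) p
          hit = proj₂ B-blocking (shadow a) (shadow b) (shadow-in-Γ a) (shadow-in-Γ b) shadows-independent
          p∈B : B (proj₁ hit)
          p∈B = proj₁ (proj₂ hit)
          γ : Fin 2 → F
          γ = proj₁ (proj₂ (proj₂ hit))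
          c : Fin 3 → F
          c = G₃.lincomb γ (a ∷ b ∷ [])
          p≈shadow : proj₁ hit ≈v shadow c
          p≈shadow = ≈v-trans (proj₂ (proj₂ (proj₂ hit))) (shadow-line γ)
          c≢0 : NonZeroV (point c)
          c≢0 c·π≡0 = proj₁ (proj₁ B-in _ p∈B)
            (≈v-trans p≈shadow (lincomb-vanishing G (π-independent c c·π≡0)))

      -- Degenerate projection: a point P = point k of π has zero shadow.  Then
      -- S is the union of the lines joining P to the other points of S.
      module Vertex (k : Fin 3 → F) (k≢0 : ¬ (∀ i → k i ≡ 0#)) (shadow-k≈0 : shadow k ≈v 0v) where
        P : V
        P = point k

        D : PointSet
        D d = S d × ¬ Proportional P d

        -- Some point of S is not P: S meets the coordinate line cᵢ = 0, where kᵢ ≠ 0.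
        off-vertex : Σ V D
        off-vertex = point c , proj₂ line , P∝̸c
          where
          nonzero-coordinate : Σ (Fin 3) λ i → k i ≢ 0#
          nonzero-coordinate = ¬∀⟶∃¬ 3 _ (λ i → k i ≟ 0#) k≢0
          i : Fin 3
          i = proj₁ nonzero-coordinate
          j l : Fin 3
          j = punchIn i 0F
          l = punchIn i 1F
          line : Σ (Fin 2 → F) λ γ → S (point (G₃.lincomb γ (δ j ∷ δ l ∷ [])))
          line = section-meets-line (δ j) (δ l)
                   (L₃.units-independent (λ j≡l → 0F≢1F (punchIn-injective i 0F 1F j≡l)))
            where
            0F≢1F : 0F ≢ 1F
            0F≢1F ()
          γ : Fin 2 → F
          γ = proj₁ line
          c : Fin 3 → F
          c = G₃.lincomb γ (δ j ∷ δ l ∷ [])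
          cᵢ≡0 : c i ≡ 0#
          cᵢ≡0 = trans (cong₂ (λ x y → γ 0F * x + (γ 1F * y + 0#))
                              (δ-off-diagonal (punchInᵢ≢i i 0F)) (δ-off-diagonal (punchInᵢ≢i i 1F)))
                       (Semiring.solve 2 (λ a b → a :* con 0 :+ (b :* con 0 :+ con 0) := con 0)
                                         refl (γ 0F) (γ 1F))
            where open Semiring using (_:+_; _:*_; _:=_; con)
          P∝̸c : ¬ Proportional P (point c)
          P∝̸c (a , a≢0 , c≈aP) = nonzero-product a≢0 (proj₂ nonzero-coordinate)
            (trans (sym (coordinates-unique π π-independent {c} {λ x → a * k x}
                                            (≈v-trans c≈aP (≈v-sym (lincomb-· a k π))) i))
                   cᵢ≡0)

        -- A nonzero point on a line ⟨P, d⟩ with d ∈ S lies in S, since its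
        -- shadow is a multiple of the shadow of d.
        on-line : ∀ v → NonZeroV v × (Σ V λ d → D d × InSpan (P ∷ d ∷ []) v) → S v
        on-line v (v≢0 , d , (d∈S , _) , γ , v≈γPd) = closed-≈ (proj₂ S-in) c∈S (≈v-sym v≈c)
          where
          e : Fin 3 → F
          e = proj₁ (proj₂ d∈S)
          d≈e : d ≈v point e
          d≈e = proj₂ (proj₂ d∈S)
          c : Fin 3 → F
          c = G₃.lincomb γ (k ∷ e ∷ [])
          v≈c : v ≈v point c
          v≈c = ≈v-trans v≈γPd
                  (≈v-trans (lincomb-congʳ γ {P ∷ d ∷ []} {point k ∷ point e ∷ []} λ { 0F → ≈v-refl ; 1F → d≈e })
                            (lincomb-lincomb γ (k ∷ e ∷ []) π))
          shadow-c : shadow c ≈v (γ 1F · shadow e)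
          shadow-c x = trans (sym (lincomb-lincomb γ (k ∷ e ∷ []) G x))
                         (trans (cong (λ t → γ 0F * t + (γ 1F * shadow e x + 0#)) (shadow-k≈0 x))
                                (Semiring.solve 2 (λ a b → a :* con 0 :+ (b :+ con 0) := b)
                                                  refl (γ 0F) (γ 1F * shadow e x)))
            where open Semiring using (_:+_; _:*_; _:=_; con)
          c∈S : S (point c)
          c∈S = section-rescale c e (γ 1F) (closed-≈ (proj₂ S-in) d∈S d≈e) (nonzero-≈ v≢0 v≈c) shadow-c

        -- Every point v of S is on such a line: ⟨P, v⟩ if v ≠ P, else ⟨P, d⟩ for any d ∈ D.
        covered : ∀ v → S v → NonZeroV v × (Σ V λ d → D d × InSpan (P ∷ d ∷ []) v)
        covered v v∈S with proportional? P v
        ... | no P∝̸v = proj₁ (proj₁ v∈S) , v , (v∈S , P∝̸v) , (0# ∷ 1# ∷ []) ,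
          λ x → solve 2 (λ p v → v := con 0 :* p :+ (con 1 :* v :+ con 0)) refl (P x) (v x)
          where open Semiring using (solve; _:+_; _:*_; _:=_; con)
        ... | yes (a , _ , v≈aP) = proj₁ (proj₁ v∈S) , proj₁ off-vertex , proj₂ off-vertex , (a ∷ 0# ∷ []) ,
          λ x → trans (v≈aP x) (solve 2 (λ ap d → ap := ap :+ (con 0 :* d :+ con 0)) refl (a * P x) (proj₁ off-vertex x))
          where open Semiring using (solve; _:+_; _:*_; _:=_; con)

        lines-through-P : IsUnionOfLinesThroughPoint π S
        lines-through-P =
          P , point-nonzero k k≢0 , (k , ≈v-refl) , D ,
          (λ { d (d∈S , P∝̸d) → proj₁ (proj₁ d∈S) , proj₂ d∈S , P∝̸d }) ,
          λ v → mk⇔ (covered v) (on-line v)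

      -- Nondegenerate projection: G is a basis of ⟨Γ⟩ and the projection
      -- point c ↦ shadow c is a collineation π → ⟨Γ⟩ mapping S onto B.
      module Projectivity (M-independent : G₃.LinIndep M) (N : Fin 3 → Fin 3 → F)
                          (NM≈δ : ∀ j → G₃.lincomb (N j) M G₃.≈v δ j) where
        G-independent : LinIndep G
        G-independent c cG≈0 =
          M-independent c (Γ-independent _ (≈v-trans (≈v-sym (lincomb-lincomb c M Γ)) cG≈0))

        Γ≈NG : ∀ j → Γ j ≈v lincomb (N j) G
        Γ≈NG j = ≈v-sym (≈v-trans (lincomb-lincomb (N j) M Γ)
                                  (≈v-trans (lincomb-congˡ Γ (NM≈δ j)) (lincomb-δ j Γ)))

        corresponds : Corresponds G B π S
        corresponds c c≢0 = mk⇔ (λ c∈B → section⇐ c (point-nonzero c c≢0) (inj₁ c∈B))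
                                (λ c∈S → shadow-in-B (section⇒ c c∈S))
          where
          shadow-in-B : B (shadow c) ⊎ shadow c ≈v 0v → B (shadow c)
          shadow-in-B (inj₁ c∈B)  = c∈B
          shadow-in-B (inj₂ c≈0) = ⊥-elim (c≢0 (G-independent c c≈0))

        S-minimal : IsMinimalBlockingSet π S
        S-minimal = transfer-minimal G B π S G-independent π-independent S-in corresponds
          (same-plane-minimal Γ G B (λ j → N j , Γ≈NG j) (λ i → M i , ≈v-refl) B-minimal)

        S-equivalent : ProjectivelyEquivalent Γ B π S
        S-equivalent =
          (λ j → lincomb (N j) π) ,
          rebase-independent G Γ π N Γ-independent π-independent Γ≈NG ,
          (λ j → N j , ≈v-refl) ,
          rebase-corresponds G B Γ π S N Γ-independent (proj₂ B-in) (proj₂ S-in) Γ≈NG corresponds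

      plane-section : IsWholePlane π S ⊎ IsUnionOfLinesThroughPoint π S
                      ⊎ (IsMinimalBlockingSet π S × ProjectivelyEquivalent Γ B π S)
      plane-section with kernel-or-inverse M
      ... | inj₁ (k , k≢0 , kM≈0) =
        inj₂ (inj₁ (Vertex.lines-through-P k k≢0 (≈v-trans (lincomb-lincomb k M Γ) (lincomb-vanishing Γ kM≈0))))
      ... | inj₂ (M-independent , N , NM≈δ) = inj₂ (inj₂ (S-minimal , S-equivalent))
        where open Projectivity M-independent N NM≈δ

lemma10 : (q : ℕ) → IsPrimePower q → (𝔽 : FiniteField q) → (m : ℕ) →
    let open Geometry 𝔽 m in
    (t : ℕ) → 1 ≤ t →
    (Ω : Fin (t ∸ 1) → V) → LinIndep Ω →
    (Γ : Fin 3 → V) → LinIndep Γ →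
    (∀ v → NonZeroV v → InSpan Ω v → InSpan Γ v → ⊥) →
    (B : PointSet) → IsMinimalBlockingSet Γ B → IsSmall B →
    (π : Fin 3 → V) → LinIndep π → (∀ i → InSpan (Ω ++ Γ) (π i)) →
      IsWholePlane π (Meet (Cone Ω B) π)
    ⊎ IsUnionOfLinesThroughPoint π (Meet (Cone Ω B) π)
    ⊎ (IsMinimalBlockingSet π (Meet (Cone Ω B) π)
       × ProjectivelyEquivalent Γ B π (Meet (Cone Ω B) π))
lemma10 q _ 𝔽 m t _ Ω _ Γ Γ-independent disjoint B B-minimal _ π π-independent π-in =
  ConeSection.plane-section 𝔽 m Ω Γ Γ-independent disjoint B B-minimal π π-independent π-in
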